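{- For every formula $\varphi$ of $\mathcal{L}$ and every goal formula $\psi$ of $\mathcal{L}$, the formulas $\square(\psi<\varphi)$ and $\square(\varphi\supset\psi)$ are equivalent, i.e. they are true in exactly the same ordered models.
   Context: Let $\mathcal{U}$ be a countable set of goal atoms. The language $\mathcal{L}$ over $\mathcal{U}$ is the smallest set containing every $a\in\mathcal{U}$ and closed under: if $\varphi,\psi\in\mathcal{L}$ then $(\neg\varphi),(\varphi\land\psi),(\square\varphi)\in\mathcal{L}$. Abbreviations: $\varphi\lor\psi:=\neg(\neg\varphi\land\neg\psi)$, $\varphi\supset\psi:=\neg\varphi\lor\psi$, $\Diamond\varphi:=\neg\square\neg\varphi$, $\varphi<\psi:=\psi\supset\Diamond\varphi$. An ordered model is a finite sequence of atoms from $\mathcal{U}$ without repetition. $P\preceq Q$ ($P$ is a prefix of $Q$) iff $Q=PR$ for some possibly empty sequence $R$ (reflexive; the empty sequence is a prefix of everything). Truth: $M\models a$ iff $a$ occurs in $M$; $M\models\neg\psi$ iff $M\not\models\psi$; $M\models\psi\land\varphi$ iff both hold; $M\models\square\varphi$ iff $M'\models\varphi$ for every prefix $M'$ of $M$. A goal formula is a formula $\psi$ with positive persistence: whenever $M\models\psi$ and $M\preceq M'$ for ordered models $M,M'$, then $M'\models\psi$. -}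

module Defs where

open import Data.Nat using (ℕ)
open import Data.List using (List; _++_)
open import Data.List.Membership.Propositional using (_∈_)
open import Data.List.Relation.Unary.Unique.Propositional using (Unique)
open import Data.Product using (Σ; _×_)
open import Relation.Binary.PropositionalEquality using (_≡_)
open import Relation.Nullary using (¬_)
open import Function.Definitions using (Injective)

Countable : Set → Set
Countable U = Σ (U → ℕ) λ f → Injective _≡_ _≡_ f

data Form (U : Set) : Set where
  atom : U → Form U
  ¬'_  : Form U → Form U
  _∧'_ : Form U → Form U → Form U
  □_   : Form U → Form U

module _ {U : Set} where
  _∨'_ : Form U → Form U → Form U
  φ ∨' ψ = ¬' ((¬' φ) ∧' (¬' ψ))

  _⊃_ : Form U → Form U → Form U
  φ ⊃ ψ = (¬' φ) ∨' ψ

  ◇_ : Form U → Form U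
  ◇ φ = ¬' (□ (¬' φ))

  _<'_ : Form U → Form U → Form U
  φ <' ψ = ψ ⊃ (◇ φ)

  OrderedModel : List U → Set
  OrderedModel M = Unique M

  _≼_ : List U → List U → Set
  P ≼ Q = Σ (List U) λ R → Q ≡ P ++ R

  _⊨_ : List U → Form U → Set
  M ⊨ atom a  = a ∈ M
  M ⊨ (¬' φ)   = ¬ (M ⊨ φ)
  M ⊨ (φ ∧' ψ) = (M ⊨ φ) × (M ⊨ ψ)
  M ⊨ (□ φ)   = (M' : List U) → OrderedModel M' → M' ≼ M → M' ⊨ φ

  GoalFormula : Form U → Set
  GoalFormula ψ = (M M' : List U) → OrderedModel M → OrderedModel M' →
                  M ≼ M' → M ⊨ ψ → M' ⊨ ψ

module Submission where

open import Defs
open import Data.List using (List; [])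
open import Data.List.Properties using (++-identityʳ)
open import Data.Product using (_,_)
open import Function.Bundles using (_⇔_; mk⇔; Equivalence)
open import Relation.Binary.PropositionalEquality using (sym)
open import Relation.Nullary using (¬_)

-- In a goal formula ψ, ◇ψ collapses to ψ: going back to a prefix is undone by
-- persistence, and the model itself is one of its prefixes. Constructively the
-- collapse only holds up to double negation, which is all the negated
-- contexts of ⊃ and <' need.

module _ {U : Set} where

  ≼-refl : (M : List U) → M ≼ M
  ≼-refl M = [] , sym (++-identityʳ M)

  ⊨⇒⊨◇ : (ψ : Form U) (M : List U) → OrderedModel M → M ⊨ ψ → M ⊨ (◇ ψ)
  ⊨⇒⊨◇ ψ M oM Mψ □¬ψ = □¬ψ M oM (≼-refl M) Mψ

  goal-⊨◇⇒¬¬⊨ : (ψ : Form U) → GoalFormula ψ → (M : List U) → OrderedModel M →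
                M ⊨ (◇ ψ) → ¬ ¬ (M ⊨ ψ)
  goal-⊨◇⇒¬¬⊨ ψ goal M oM ◇ψ ¬ψ =
    ◇ψ λ M' oM' M'≼M M'ψ → ¬ψ (goal M' M oM' oM M'≼M M'ψ)

  goal-<'⇔⊃ : (φ ψ : Form U) → GoalFormula ψ → (M : List U) → OrderedModel M →
              (M ⊨ (ψ <' φ)) ⇔ (M ⊨ (φ ⊃ ψ))
  goal-<'⇔⊃ φ ψ goal M oM = mk⇔
    (λ ψ<φ (¬¬φ , ¬ψ) → ψ<φ (¬¬φ , λ ◇ψ → goal-⊨◇⇒¬¬⊨ ψ goal M oM ◇ψ ¬ψ))
    (λ φ⊃ψ (¬¬φ , ¬◇ψ) → φ⊃ψ (¬¬φ , λ Mψ → ¬◇ψ (⊨⇒⊨◇ ψ M oM Mψ)))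

  □-cong : (χ χ' : Form U) →
           ((M : List U) → OrderedModel M → (M ⊨ χ) ⇔ (M ⊨ χ')) →
           (M : List U) → (M ⊨ (□ χ)) ⇔ (M ⊨ (□ χ'))
  □-cong χ χ' χ⇔χ' M = mk⇔
    (λ □χ M' oM' M'≼M → Equivalence.to (χ⇔χ' M' oM') (□χ M' oM' M'≼M))
    (λ □χ' M' oM' M'≼M → Equivalence.from (χ⇔χ' M' oM') (□χ' M' oM' M'≼M))

theorem2 : (U : Set) → Countable U → (φ ψ : Form U) → GoalFormula ψ →
    (M : List U) → OrderedModel M →
    ((M ⊨ (□ (ψ <' φ))) ⇔ (M ⊨ (□ (φ ⊃ ψ))))
theorem2 U _ φ ψ goal M _ = □-cong (ψ <' φ) (φ ⊃ ψ) (goal-<'⇔⊃ φ ψ goal) M
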